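{- For each $i\in\{1,2,3,4,5\}$, every positive edge of $\widehat{\Gamma}_i$ is contained in an equilibrated cut of $\widehat{\Gamma}_i$.
   Context: An edge cut $[X,X^c]$ of a signed graph is equilibrated if it contains equally many negative and positive edges. The signed graphs: $\widehat{\Gamma}_1$ is $K_4$ on $\{p_1,\dots,p_4\}$ with $p_1p_2,p_3p_4$ negative, others positive. $\widehat{\Gamma}_2$: replace edge $p_1p_2$ of $\widehat{\Gamma}_1$ by a path $p_1qp_2$, $p_1q$ negative, $qp_2$ positive. $\widehat{\Gamma}_3$: vertices $x_0,y_0,x_1,\dots,x_6$, edges $x_1x_2,x_2x_3,x_3x_4,x_4x_5,x_5x_6,x_6x_1,x_0x_1,x_0x_2,x_0x_6,y_0x_3,y_0x_4,y_0x_5$, negative edges exactly $x_5x_6,x_0x_1,y_0x_4$. $\widehat{\Gamma}_4$: vertices $x_0,y_0,z_0,x_1,\dots,x_5$, edges $x_1x_2,x_2x_3,x_3x_4,x_4x_5,x_5x_1,y_0x_3,y_0x_4,x_0x_1,x_0x_2,x_0z_0,z_0y_0,z_0x_5$, negative edges exactly $x_3x_4,x_0x_2,x_5z_0$. $\widehat{\Gamma}_5$: cube with vertices $u_1,..,u_4,v_1,..,v_4$, edges $u_1u_2,u_2u_3,u_3u_4,u_4u_1,v_1v_2,v_2v_3,v_3v_4,v_4v_1,u_iv_i$ ($i=1,..,4$), negative edges exactly $u_4u_1,v_3v_4,u_2v_2$. -}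

module Defs where

open import Data.Nat using (ℕ)
open import Data.Bool using (Bool; true; false; _xor_; _∧_)
open import Data.Fin using (Fin; zero; suc; #_)
open import Data.Fin.Subset using (Subset)
open import Data.Vec using (lookup)
open import Data.Product using (_×_; _,_)
open import Data.List using (List; []; _∷_; length; filterᵇ)
open import Relation.Binary.PropositionalEquality using (_≡_)

data Sign : Set where
  pos neg : Sign

isPos : Sign → Bool
isPos pos = true
isPos neg = false

isNeg : Sign → Bool
isNeg pos = false
isNeg neg = true

SEdge : ℕ → Set
SEdge n = Fin n × Fin n × Sign

record SignedGraph : Set where
  constructor sg
  field
    nV    : ℕ
    edges : List (SEdge nV)
open SignedGraph public

crossesᵇ : ∀ {n} → Subset n → SEdge n → Bool
crossesᵇ X (u , v , _) = lookup X u xor lookup X v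

cut : (G : SignedGraph) → Subset (nV G) → List (SEdge (nV G))
cut G X = filterᵇ (crossesᵇ X) (edges G)

#pos #neg : ∀ {n} → List (SEdge n) → ℕ
#pos es = length (filterᵇ (λ { (_ , _ , s) → isPos s }) es)
#neg es = length (filterᵇ (λ { (_ , _ , s) → isNeg s }) es)

Equilibrated : (G : SignedGraph) → Subset (nV G) → Set
Equilibrated G X = #pos (cut G X) ≡ #neg (cut G X)

-- Γ̂₁ : K4 on p1..p4 = 0..3, p1p2 and p3p4 negative
Γ₁ : SignedGraph
Γ₁ = sg 4
  ( (# 0 , # 1 , neg) ∷ (# 2 , # 3 , neg) ∷ (# 0 , # 2 , pos) ∷ (# 0 , # 3 , pos)
  ∷ (# 1 , # 2 , pos) ∷ (# 1 , # 3 , pos) ∷ [])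

-- Γ̂₂ : p1..p4 = 0..3, q = 4; p1p2 replaced by p1 q (neg), q p2 (pos)
Γ₂ : SignedGraph
Γ₂ = sg 5
  ( (# 0 , # 4 , neg) ∷ (# 4 , # 1 , pos) ∷ (# 2 , # 3 , neg) ∷ (# 0 , # 2 , pos)
  ∷ (# 0 , # 3 , pos) ∷ (# 1 , # 2 , pos) ∷ (# 1 , # 3 , pos) ∷ [])

-- Γ̂₃ : x0 = 0, y0 = 1, x1..x6 = 2..7
Γ₃ : SignedGraph
Γ₃ = sg 8
  ( (# 2 , # 3 , pos) ∷ (# 3 , # 4 , pos) ∷ (# 4 , # 5 , pos) ∷ (# 5 , # 6 , pos)
  ∷ (# 6 , # 7 , neg) ∷ (# 7 , # 2 , pos) ∷ (# 0 , # 2 , neg) ∷ (# 0 , # 3 , pos)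
  ∷ (# 0 , # 7 , pos) ∷ (# 1 , # 4 , pos) ∷ (# 1 , # 5 , neg) ∷ (# 1 , # 6 , pos) ∷ [])

-- Γ̂₄ : x0 = 0, y0 = 1, z0 = 2, x1..x5 = 3..7
Γ₄ : SignedGraph
Γ₄ = sg 8
  ( (# 3 , # 4 , pos) ∷ (# 4 , # 5 , pos) ∷ (# 5 , # 6 , neg) ∷ (# 6 , # 7 , pos)
  ∷ (# 7 , # 3 , pos) ∷ (# 1 , # 5 , pos) ∷ (# 1 , # 6 , pos) ∷ (# 0 , # 3 , pos)
  ∷ (# 0 , # 4 , neg) ∷ (# 0 , # 2 , pos) ∷ (# 2 , # 1 , pos) ∷ (# 2 , # 7 , neg) ∷ [])

-- Γ̂₅ : cube, u1..u4 = 0..3, v1..v4 = 4..7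
Γ₅ : SignedGraph
Γ₅ = sg 8
  ( (# 0 , # 1 , pos) ∷ (# 1 , # 2 , pos) ∷ (# 2 , # 3 , pos) ∷ (# 3 , # 0 , neg)
  ∷ (# 4 , # 5 , pos) ∷ (# 5 , # 6 , pos) ∷ (# 6 , # 7 , neg) ∷ (# 7 , # 4 , pos)
  ∷ (# 0 , # 4 , pos) ∷ (# 1 , # 5 , neg) ∷ (# 2 , # 6 , pos) ∷ (# 3 , # 7 , pos) ∷ [])

-- the family Γ̂₁ … Γ̂₅ indexed by Fin 5 (index k ↦ Γ̂_{k+1})
Γ : Fin 5 → SignedGraph
Γ zero = Γ₁
Γ (suc zero) = Γ₂
Γ (suc (suc zero)) = Γ₃
Γ (suc (suc (suc zero))) = Γ₄
Γ (suc (suc (suc (suc zero)))) = Γ₅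

{-# OPTIONS --safe #-}
module Submission where

-- Each positive edge is certified by an explicit vertex set X; that the edge crosses
-- [X , X^c] and that this cut is equilibrated are both closed computations.

open import Defs
open import Data.Fin using (Fin; zero; suc; #_)
open import Data.Fin.Subset using (Subset; ⁅_⁆; ⋃)
open import Data.Bool using (true)
open import Data.Unit using (⊤; tt)
open import Data.Product using (Σ; _×_; _,_)
open import Data.List using (List; []; _∷_; map)
open import Data.List.Relation.Unary.All as All using (All; []; _∷_)
open import Data.List.Membership.Propositional using (_∈_)
open import Relation.Binary.PropositionalEquality using (_≡_; refl)

subsetOf : ∀ {n} → List (Fin n) → Subset n
subsetOf xs = ⋃ (map ⁅_⁆ xs)

InEquilibratedCut : (G : SignedGraph) → SEdge (nV G) → Set
InEquilibratedCut G e = Σ (Subset (nV G)) (λ X → (crossesᵇ X e ≡ true) × Equilibrated G X)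

PositiveEdgeCovered : (G : SignedGraph) → SEdge (nV G) → Set
PositiveEdgeCovered G (u , v , pos) = InEquilibratedCut G (u , v , pos)
PositiveEdgeCovered G (u , v , neg) = ⊤

positive-edge-in-equilibrated-cut : (G : SignedGraph) → All (PositiveEdgeCovered G) (edges G)
  → ∀ {u v} → (u , v , pos) ∈ edges G → InEquilibratedCut G (u , v , pos)
positive-edge-in-equilibrated-cut G covered = All.lookup covered

Γ₁-positive-edges-covered : All (PositiveEdgeCovered Γ₁) (edges Γ₁)
Γ₁-positive-edges-covered
  = tt
  ∷ tt
  ∷ (subsetOf (# 1 ∷ # 2 ∷ []) , refl , refl)
  ∷ (subsetOf (# 1 ∷ # 3 ∷ []) , refl , refl)
  ∷ (subsetOf (# 1 ∷ # 3 ∷ []) , refl , refl)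
  ∷ (subsetOf (# 1 ∷ # 2 ∷ []) , refl , refl)
  ∷ []

Γ₂-positive-edges-covered : All (PositiveEdgeCovered Γ₂) (edges Γ₂)
Γ₂-positive-edges-covered
  = tt
  ∷ (subsetOf (# 4 ∷ []) , refl , refl)
  ∷ tt
  ∷ (subsetOf (# 0 ∷ # 3 ∷ []) , refl , refl)
  ∷ (subsetOf (# 0 ∷ # 2 ∷ []) , refl , refl)
  ∷ (subsetOf (# 0 ∷ # 2 ∷ []) , refl , refl)
  ∷ (subsetOf (# 0 ∷ # 3 ∷ []) , refl , refl)
  ∷ []

Γ₃-positive-edges-covered : All (PositiveEdgeCovered Γ₃) (edges Γ₃)
Γ₃-positive-edges-covered
  = (subsetOf (# 2 ∷ # 7 ∷ []) , refl , refl)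
  ∷ (subsetOf (# 1 ∷ # 4 ∷ # 5 ∷ # 6 ∷ []) , refl , refl)
  ∷ (subsetOf (# 5 ∷ # 6 ∷ []) , refl , refl)
  ∷ (subsetOf (# 1 ∷ # 6 ∷ []) , refl , refl)
  ∷ tt
  ∷ (subsetOf (# 0 ∷ # 7 ∷ []) , refl , refl)
  ∷ tt
  ∷ (subsetOf (# 0 ∷ # 7 ∷ []) , refl , refl)
  ∷ (subsetOf (# 2 ∷ # 7 ∷ []) , refl , refl)
  ∷ (subsetOf (# 1 ∷ # 6 ∷ []) , refl , refl)
  ∷ tt
  ∷ (subsetOf (# 5 ∷ # 6 ∷ []) , refl , refl)
  ∷ []

Γ₄-positive-edges-covered : All (PositiveEdgeCovered Γ₄) (edges Γ₄)
Γ₄-positive-edges-covered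
  = (subsetOf (# 4 ∷ # 5 ∷ []) , refl , refl)
  ∷ (subsetOf (# 3 ∷ # 4 ∷ # 6 ∷ # 7 ∷ []) , refl , refl)
  ∷ tt
  ∷ (subsetOf (# 3 ∷ # 4 ∷ # 5 ∷ # 7 ∷ []) , refl , refl)
  ∷ (subsetOf (# 6 ∷ # 7 ∷ []) , refl , refl)
  ∷ (subsetOf (# 4 ∷ # 5 ∷ []) , refl , refl)
  ∷ (subsetOf (# 6 ∷ # 7 ∷ []) , refl , refl)
  ∷ (subsetOf (# 3 ∷ # 4 ∷ # 6 ∷ # 7 ∷ []) , refl , refl)
  ∷ tt
  ∷ (subsetOf (# 1 ∷ # 2 ∷ # 4 ∷ # 5 ∷ []) , refl , refl)
  ∷ (subsetOf (# 0 ∷ # 2 ∷ []) , refl , refl)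
  ∷ tt
  ∷ []

Γ₅-positive-edges-covered : All (PositiveEdgeCovered Γ₅) (edges Γ₅)
Γ₅-positive-edges-covered
  = (subsetOf (# 1 ∷ # 2 ∷ # 3 ∷ # 7 ∷ []) , refl , refl)
  ∷ (subsetOf (# 2 ∷ # 3 ∷ # 5 ∷ # 6 ∷ []) , refl , refl)
  ∷ (subsetOf (# 3 ∷ # 7 ∷ []) , refl , refl)
  ∷ tt
  ∷ (subsetOf (# 5 ∷ # 6 ∷ []) , refl , refl)
  ∷ (subsetOf (# 3 ∷ # 4 ∷ # 5 ∷ # 7 ∷ []) , refl , refl)
  ∷ tt
  ∷ (subsetOf (# 3 ∷ # 7 ∷ []) , refl , refl)
  ∷ (subsetOf (# 3 ∷ # 4 ∷ # 5 ∷ # 7 ∷ []) , refl , refl)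
  ∷ tt
  ∷ (subsetOf (# 5 ∷ # 6 ∷ []) , refl , refl)
  ∷ (subsetOf (# 2 ∷ # 3 ∷ # 5 ∷ # 6 ∷ []) , refl , refl)
  ∷ []

Γ-positive-edges-covered : (i : Fin 5) → All (PositiveEdgeCovered (Γ i)) (edges (Γ i))
Γ-positive-edges-covered zero                         = Γ₁-positive-edges-covered
Γ-positive-edges-covered (suc zero)                   = Γ₂-positive-edges-covered
Γ-positive-edges-covered (suc (suc zero))             = Γ₃-positive-edges-covered
Γ-positive-edges-covered (suc (suc (suc zero)))       = Γ₄-positive-edges-covered
Γ-positive-edges-covered (suc (suc (suc (suc zero)))) = Γ₅-positive-edges-covered

corollary4p2 : (i : Fin 5) → (u v : Fin (nV (Γ i))) → (u , v , pos) ∈ edges (Γ i)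
    → Σ (Subset (nV (Γ i))) (λ X → (crossesᵇ X (u , v , pos) ≡ true) × Equilibrated (Γ i) X)
corollary4p2 i u v = positive-edge-in-equilibrated-cut (Γ i) (Γ-positive-edges-covered i)
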